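{- Let $a,b,c\in\mathbf{Z}$ be such that $f(x)=x^3+ax^2+bx+c$ has three distinct complex roots. Suppose $(u,v)\in\Psi$, $t$ is a positive integer, and $t^2\mid F(u,v)$. Then there exists a unique triple $(\alpha,d,d')\in\mathcal{S}$ such that $(u,v)\in\mathcal{L}_{\alpha,d,d'}$ and $dd'=t$.
   Context: $F(u,v)=v(u^3+au^2v+buv^2+cv^3)$; $\Psi=\{(u,v)\in\mathbf{Z}^2:\gcd(u,v)=1,\ F(u,v)\neq0\}$. For a positive integer $d$, $\Omega_d=\{\alpha\in\mathbf{Z}/d^2\mathbf{Z}: f(\alpha)\equiv0\pmod{d^2}\}$. $\mathcal{S}=\{(\alpha,d,d'): d,d'\in\mathbf{Z}_{>0},\ \gcd(d,d')=1,\ \alpha\in\Omega_d\}$. For positive integers $d,d'$ and $\alpha\in\Omega_d$, $\mathcal{L}_{\alpha,d,d'}=\{(u,v)\in\mathbf{Z}^2: u\equiv\alpha v\pmod{d^2},\ v\equiv0\pmod{(d')^2}\}$. -}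

module Defs where

open import Data.Nat as ℕ using (ℕ)
open import Data.Integer using (ℤ; +_; _+_; _-_; _*_; _^_)
open import Data.Integer.Divisibility using (_∣_)
open import Data.Integer.GCD using (gcd)
open import Data.Nat.Coprimality using (Coprime)
open import Data.Product using (_×_)
open import Relation.Binary.PropositionalEquality using (_≡_; _≢_)

f : ℤ → ℤ → ℤ → ℤ → ℤ
f a b c x = x ^ 3 + a * x ^ 2 + b * x + c

disc : ℤ → ℤ → ℤ → ℤ
disc a b c = + 18 * a * b * c - + 4 * a ^ 3 * c + a ^ 2 * b ^ 2 - + 4 * b ^ 3 - + 27 * c ^ 2

F : ℤ → ℤ → ℤ → ℤ → ℤ → ℤ
F a b c u v = v * (u ^ 3 + a * u ^ 2 * v + b * u * v ^ 2 + c * v ^ 3)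

InΨ : ℤ → ℤ → ℤ → ℤ → ℤ → Set
InΨ a b c u v = (gcd u v ≡ + 1) × (F a b c u v ≢ + 0)

-- α ∈ Ω_d, with α a residue mod d² represented by its least nonnegative representative
InΩ : ℤ → ℤ → ℤ → ℕ → ℕ → Set
InΩ a b c d α = (α ℕ.< d ℕ.* d) × ((+ (d ℕ.* d)) ∣ f a b c (+ α))

InS : ℤ → ℤ → ℤ → ℕ → ℕ → ℕ → Set
InS a b c α d d' = (0 ℕ.< d) × (0 ℕ.< d') × Coprime d d' × InΩ a b c d α

InL : ℕ → ℕ → ℕ → ℤ → ℤ → Set
InL α d d' u v = ((+ (d ℕ.* d)) ∣ (u - + α * v)) × ((+ (d' ℕ.* d')) ∣ v)

-- Let G(u,v) = u³ + a u²v + b uv² + c v³, so that F = v·G. As gcd(u,v) = 1, v and G are coprime,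
-- so t² ∣ vG splits t uniquely as t = d·d' with d ∣ G and d' ∣ v (namely d = gcd(t,G), d' = gcd(t,v)),
-- and then d² ∣ G and d'² ∣ v. Since d is prime to v there is exactly one residue α mod d² with
-- u ≡ αv, and the identity G(u,v) = v³ f(α) + (u - αv)·q turns d² ∣ G into d² ∣ f(α) and back.
module Submission where

module CoprimeFactorisation where

  open import Data.Nat using (ℕ; zero; suc; _*_; _<_; NonZero; >-nonZero⁻¹)
  open import Data.Product using (_×_; _,_; proj₁; proj₂)
  open import Relation.Binary.PropositionalEquality
  open import Data.Empty using (⊥-elim)
  open import Data.Nat.Properties as ℕ using (*-comm; *-assoc; *-cancelʳ-≡)
  open import Data.Nat.Divisibility
  open import Data.Nat.GCD using (gcd; gcd[m,n]∣m; gcd[m,n]∣n; gcd-greatest; c*gcd[m,n]≡gcd[cm,cn])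
  open import Data.Nat.LCM using (lcm; lcm-least; gcd*lcm)
  open import Data.Nat.Coprimality as Coprimality using (Coprime; coprime-divisor; coprime⇒gcd≡1)

  private variable k m n o p t : ℕ

  coprime-∣ˡ : k ∣ m → Coprime m n → Coprime k n
  coprime-∣ˡ k∣m m⊥n (i∣k , i∣n) = m⊥n (∣-trans i∣k k∣m , i∣n)

  coprime-*ˡ : Coprime m n → Coprime o n → Coprime (m * o) n
  coprime-*ˡ m⊥n o⊥n (i∣mo , i∣n) =
    o⊥n (coprime-divisor (coprime-∣ˡ i∣n (Coprimality.sym m⊥n)) i∣mo , i∣n)

  coprime⇒*∣ : Coprime m n → m ∣ k → n ∣ k → m * n ∣ k
  coprime⇒*∣ {m} {n} m⊥n m∣k n∣k = subst (_∣ _) lcm≡mn (lcm-least m∣k n∣k)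
    where
    lcm≡mn : lcm m n ≡ m * n
    lcm≡mn = trans (sym (ℕ.*-identityˡ (lcm m n)))
               (trans (cong (_* lcm m n) (sym (coprime⇒gcd≡1 m⊥n))) (gcd*lcm m n))

  ∣*⇒∣gcd*gcd : t ∣ m * n → t ∣ gcd t m * gcd t n
  ∣*⇒∣gcd*gcd {t} {m} {n} t∣mn =
    subst (t ∣_) (trans (sym (c*gcd[m,n]≡gcd[cm,cn] g' t m)) (*-comm g' (gcd t m)))
      (gcd-greatest (n∣m*n g') (subst (t ∣_) (*-comm m g') t∣mg'))
    where
    g' = gcd t n
    t∣mg' : t ∣ m * g'
    t∣mg' = subst (t ∣_) (sym (c*gcd[m,n]≡gcd[cm,cn] m t n)) (gcd-greatest (n∣m*n m) t∣mn)

  m*n≡o*p⇒p∣n⇒m∣o : .{{NonZero p}} → m * n ≡ o * p → p ∣ n → m ∣ o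
  m*n≡o*p⇒p∣n⇒m∣o {p} {m} {o = o} eq (divides-refl q) = divides q (*-cancelʳ-≡ o (q * m) p (begin
    o * p        ≡⟨ sym eq ⟩
    m * (q * p)  ≡⟨ sym (*-assoc m q p) ⟩
    m * q * p    ≡⟨ cong (_* p) (*-comm m q) ⟩
    q * m * p    ∎))
    where open ≡-Reasoning

  ∣∧<⇒≡0 : m ∣ n → n < m → n ≡ 0
  ∣∧<⇒≡0 {n = zero} _ _ = refl
  ∣∧<⇒≡0 {n = suc _} m∣n n<m = ⊥-elim (>⇒∤ n<m m∣n)

  nonZero-factors : .{{NonZero t}} → m * n ≡ t → NonZero m × NonZero n
  nonZero-factors {m = m} refl = ℕ.m*n≢0⇒m≢0 m , ℕ.m*n≢0⇒n≢0 m

  coprime∧∣⇒²∣ : Coprime k n → k ∣ t → t * t ∣ m * n → k * k ∣ m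
  coprime∧∣⇒²∣ {k} {n} {t} {m} k⊥n k∣t t²∣mn = coprime-divisor (coprime-*ˡ k⊥n k⊥n)
    (subst (k * k ∣_) (*-comm m n) (∣-trans (*-pres-∣ k∣t k∣t) t²∣mn))

  module CoprimeSplitting {m n t : ℕ} .{{_ : NonZero t}} (m⊥n : Coprime m n) (t²∣mn : t * t ∣ m * n) where

    d d' : ℕ
    d  = gcd t m
    d' = gcd t n

    d⊥d' : Coprime d d'
    d⊥d' = coprime-∣ˡ (gcd[m,n]∣n t m) (Coprimality.sym (coprime-∣ˡ (gcd[m,n]∣n t n) (Coprimality.sym m⊥n)))

    d*d'≡t : d * d' ≡ t
    d*d'≡t = ∣-antisym (coprime⇒*∣ d⊥d' (gcd[m,n]∣m t m) (gcd[m,n]∣m t n))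
                       (∣*⇒∣gcd*gcd (∣-trans (m∣m*n t) t²∣mn))

    0<d : 0 < d
    0<d = >-nonZero⁻¹ d {{proj₁ (nonZero-factors {m = d} {n = d'} d*d'≡t)}}

    0<d' : 0 < d'
    0<d' = >-nonZero⁻¹ d' {{proj₂ (nonZero-factors {m = d} {n = d'} d*d'≡t)}}

    d²∣m : d * d ∣ m
    d²∣m = coprime∧∣⇒²∣ (coprime-∣ˡ (gcd[m,n]∣n t m) m⊥n) (gcd[m,n]∣m t m) t²∣mn

    d'²∣n : d' * d' ∣ n
    d'²∣n = coprime∧∣⇒²∣ (coprime-∣ˡ (gcd[m,n]∣n t n) (Coprimality.sym m⊥n)) (gcd[m,n]∣m t n)
              (subst (t * t ∣_) (*-comm m n) t²∣mn)

    splitting-unique : ∀ {e e'} → e * e' ≡ t → e ∣ m → e' ∣ n → e ≡ d × e' ≡ d'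
    splitting-unique {e} {e'} eq e∣m e'∣n with nonZero-factors eq
    ... | e≢0 , e'≢0 = ∣-antisym e∣d (m*n≡o*p⇒p∣n⇒m∣o {{e'≢0}} (trans d*d'≡t (sym eq)) e'∣d')
                     , ∣-antisym e'∣d' (m*n≡o*p⇒p∣n⇒m∣o {{e≢0}} d'*d≡e'*e e∣d)
      where
      e∣d : e ∣ d
      e∣d = gcd-greatest (subst (e ∣_) eq (m∣m*n e')) e∣m
      e'∣d' : e' ∣ d'
      e'∣d' = gcd-greatest (subst (e' ∣_) eq (n∣m*n e)) e'∣n
      d'*d≡e'*e : d' * d ≡ e' * e
      d'*d≡e'*e = trans (*-comm d' d) (trans (trans d*d'≡t (sym eq)) (*-comm e e'))

open import Defs
open import Data.Nat as ℕ using (ℕ; zero; suc; NonZero)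
import Data.Nat.Properties as ℕ
import Data.Nat.Divisibility as ℕ
import Data.Nat.Coprimality as ℕ
open import Data.Nat.GCD using (module Bézout)
open import Data.Integer using (ℤ; +_; -[1+_]; _+_; _-_; _*_; _^_; -_; ∣_∣; 1ℤ)
import Data.Integer.Properties as ℤ
open import Data.Integer.Divisibility using (_∣_)
open import Data.Integer.Divisibility.Signed as Signed using (∣ᵤ⇒∣; ∣⇒∣ᵤ; divides)
open import Data.Integer.Coprimality using (Coprime; coprime-divisor)
open import Data.Integer.DivMod using (_%ℕ_; _/ℕ_; a≡a%ℕn+[a/ℕn]*n; n%ℕd<d)
open import Data.Integer.Tactic.RingSolver using (solve-∀)
open import Data.Product using (Σ; _×_; _,_; ∃-syntax; proj₁; proj₂)
open import Relation.Binary.PropositionalEquality using (_≡_; _≢_; sym; trans; cong; subst; module ≡-Reasoning)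
open CoprimeFactorisation using (coprime-∣ˡ; ∣∧<⇒≡0; module CoprimeSplitting)

cubicForm : ℤ → ℤ → ℤ → ℤ → ℤ → ℤ
cubicForm a b c u v = u ^ 3 + a * u ^ 2 * v + b * u * v ^ 2 + c * v ^ 3

-- The identities below spell x ^ n out as x * (⋯ * (x * 1ℤ)), its definitional unfolding, since
-- the ring solver does not recognise Data.Integer._^_.
cubicForm≡u³+v* : ∀ a b c u v → ∃[ r ] cubicForm a b c u v ≡ u ^ 3 + v * r
cubicForm≡u³+v* a b c u v = a * u ^ 2 + b * u * v + c * v ^ 2 , identity a b c u v
  where
  identity : ∀ a b c u v →
    u * (u * (u * 1ℤ)) + a * (u * (u * 1ℤ)) * v + b * u * (v * (v * 1ℤ)) + c * (v * (v * (v * 1ℤ)))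
      ≡ u * (u * (u * 1ℤ)) + v * (a * (u * (u * 1ℤ)) + b * u * v + c * (v * (v * 1ℤ)))
  identity = solve-∀

cubicForm≡v³f+[u-xv]* : ∀ a b c u v x → ∃[ q ] cubicForm a b c u v ≡ v ^ 3 * f a b c x + (u - x * v) * q
cubicForm≡v³f+[u-xv]* a b c u v x =
  x * v * (x * v) + x * v * u + u * u + a * v * (x * v + u) + b * v * v , identity a b c u v x
  where
  identity : ∀ a b c u v x →
    u * (u * (u * 1ℤ)) + a * (u * (u * 1ℤ)) * v + b * u * (v * (v * 1ℤ)) + c * (v * (v * (v * 1ℤ)))
      ≡ v * (v * (v * 1ℤ)) * (x * (x * (x * 1ℤ)) + a * (x * (x * 1ℤ)) + b * x + c)
        + (u - x * v) * (x * v * (x * v) + x * v * u + u * u + a * v * (x * v + u) + b * v * v)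
  identity = solve-∀

coprime-divisor-^ : ∀ i j k n → Coprime i j → i ∣ j ^ n * k → i ∣ k
coprime-divisor-^ i j k zero    i⊥j i∣ = subst (i ∣_) (ℤ.*-identityˡ k) i∣
coprime-divisor-^ i j k (suc n) i⊥j i∣ =
  coprime-divisor-^ i j k n i⊥j (coprime-divisor i j (j ^ n * k) i⊥j (subst (i ∣_) (ℤ.*-assoc j (j ^ n) k) i∣))

-- The _∣_ of Defs compares absolute values, so its arguments cannot be inferred from a proof;
-- sums are handled through Data.Integer.Divisibility.Signed.
coprime-cubicForm : ∀ a b c u v → Coprime u v → Coprime v (cubicForm a b c u v)
coprime-cubicForm a b c u v u⊥v {k} (k∣v , k∣G) with cubicForm≡u³+v* a b c u v
... | r , G≡ = ℕ.∣1⇒≡1 (coprime-divisor-^ (+ k) u 1ℤ 3 k⊥u (subst (+ k ∣_) (sym (ℤ.*-identityʳ (u ^ 3))) k∣u³))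
  where
  k⊥u : Coprime (+ k) u
  k⊥u (i∣k , i∣u) = u⊥v (i∣u , ℕ.∣-trans i∣k k∣v)
  k∣u³ : + k ∣ u ^ 3
  k∣u³ = ∣⇒∣ᵤ {+ k} {u ^ 3} (Signed.∣m+n∣n⇒∣m (subst (+ k Signed.∣_) G≡ (∣ᵤ⇒∣ k∣G)) (Signed.∣m⇒∣m*n r (∣ᵤ⇒∣ {+ k} {v} k∣v)))

module _ (a b c : ℤ) {n : ℕ} (u v x : ℤ) (n∣u-xv : + n ∣ u - x * v) where

  ∣f⇒∣cubicForm : + n ∣ f a b c x → + n ∣ cubicForm a b c u v
  ∣f⇒∣cubicForm n∣fx with cubicForm≡v³f+[u-xv]* a b c u v x
  ... | q , G≡ = ∣⇒∣ᵤ {+ n} {cubicForm a b c u v} (subst (+ n Signed.∣_) (sym G≡)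
    (Signed.∣m∣n⇒∣m+n (Signed.∣n⇒∣m*n (v ^ 3) (∣ᵤ⇒∣ {+ n} {f a b c x} n∣fx))
                      (Signed.∣m⇒∣m*n q (∣ᵤ⇒∣ {+ n} {u - x * v} n∣u-xv))))

  ∣cubicForm⇒∣f : Coprime (+ n) v → + n ∣ cubicForm a b c u v → + n ∣ f a b c x
  ∣cubicForm⇒∣f n⊥v n∣G with cubicForm≡v³f+[u-xv]* a b c u v x
  ... | q , G≡ = coprime-divisor-^ (+ n) v (f a b c x) 3 n⊥v (∣⇒∣ᵤ {+ n} {v ^ 3 * f a b c x}
    (Signed.∣m+n∣n⇒∣m (subst (+ n Signed.∣_) G≡ (∣ᵤ⇒∣ {+ n} {cubicForm a b c u v} n∣G))
                      (Signed.∣m⇒∣m*n q (∣ᵤ⇒∣ {+ n} {u - x * v} n∣u-xv))))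

coprime⇒invertible : ∀ {n} v → Coprime (+ n) v → ∃[ w ] + n ∣ w * v - 1ℤ
coprime⇒invertible {n} (+ V) n⊥V with ℕ.coprime-Bézout n⊥V
... | Bézout.+- x y eq = - + y , subst (+ n ∣_) (sym (begin
  - + y * + V - 1ℤ        ≡⟨ identity (+ y) (+ V) ⟩
  - (1ℤ + + y * + V)      ≡⟨ cong (λ z → - (1ℤ + z)) (sym (ℤ.pos-* y V)) ⟩
  - + (1 ℕ.+ y ℕ.* V)     ≡⟨ cong (λ z → - + z) eq ⟩
  - + (x ℕ.* n)           ∎)) (subst (n ℕ.∣_) (sym (ℤ.∣-i∣≡∣i∣ (+ (x ℕ.* n)))) (ℕ.n∣m*n x))
  where
  open ≡-Reasoning
  identity : ∀ i j → - i * j - 1ℤ ≡ - (1ℤ + i * j)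
  identity = solve-∀
... | Bézout.-+ x y eq = + y , subst (+ n ∣_) (sym (begin
  + y * + V - 1ℤ          ≡⟨ cong (_- 1ℤ) (sym (ℤ.pos-* y V)) ⟩
  + (y ℕ.* V) - 1ℤ        ≡⟨ cong (λ z → + z - 1ℤ) (sym eq) ⟩
  + (x ℕ.* n)             ∎)) (ℕ.n∣m*n x)
  where open ≡-Reasoning
coprime⇒invertible {n} -[1+ V ] n⊥v with coprime⇒invertible (+ suc V) n⊥v
... | w , n∣wV-1 = - w , subst (λ z → + n ∣ z - 1ℤ) (identity w (+ suc V)) n∣wV-1
  where
  identity : ∀ i j → i * j ≡ - i * - j
  identity = solve-∀

module ResidueClass {n : ℕ} .{{_ : NonZero n}} (u v : ℤ) (n⊥v : Coprime (+ n) v) where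

  private
    w : ℤ
    w = proj₁ (coprime⇒invertible v n⊥v)
    n∣wv-1 : + n ∣ w * v - 1ℤ
    n∣wv-1 = proj₂ (coprime⇒invertible v n⊥v)

  α : ℕ
  α = (u * w) %ℕ n

  α<n : α ℕ.< n
  α<n = n%ℕd<d (u * w) n

  n∣u-αv : + n ∣ u - + α * v
  n∣u-αv = ∣⇒∣ᵤ {+ n} {u - + α * v} (subst (+ n Signed.∣_) (sym (identity u v w (+ α)))
    (Signed.∣m∣n⇒∣m+n (Signed.∣n⇒∣m*n (- u) (∣ᵤ⇒∣ {+ n} {w * v - 1ℤ} n∣wv-1))
                      (Signed.∣m⇒∣m*n v n∣uw-α)))
    where
    identity : ∀ u v w α → u - α * v ≡ - u * (w * v - 1ℤ) + (u * w - α) * v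
    identity = solve-∀
    cancel : ∀ i j → i + j - i ≡ j
    cancel = solve-∀
    n∣uw-α : + n Signed.∣ u * w - + α
    n∣uw-α = divides ((u * w) /ℕ n)
      (trans (cong (_- + α) (a≡a%ℕn+[a/ℕn]*n (u * w) n)) (cancel (+ α) ((u * w) /ℕ n * + n)))

  residue-unique : ∀ {β} → β ℕ.< n → + n ∣ u - + β * v → β ≡ α
  residue-unique {β} β<n n∣u-βv =
    ℤ.+-injective (ℤ.i-j≡0⇒i≡j (+ β) (+ α) (ℤ.∣i∣≡0⇒i≡0 (∣∧<⇒≡0 n∣β-α ∣β-α∣<n)))
    where
    identity : ∀ u v α β → (u - α * v) - (u - β * v) ≡ v * (β - α)
    identity = solve-∀
    n∣β-α : + n ∣ + β - + α
    n∣β-α = coprime-divisor (+ n) v (+ β - + α) n⊥v (∣⇒∣ᵤ {+ n} {v * (+ β - + α)}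
      (subst (+ n Signed.∣_) (identity u v (+ α) (+ β))
        (Signed.∣m∣n⇒∣m-n (∣ᵤ⇒∣ {+ n} {u - + α * v} n∣u-αv) (∣ᵤ⇒∣ {+ n} {u - + β * v} n∣u-βv))))
    ∣β-α∣<n : ∣ + β - + α ∣ ℕ.< n
    ∣β-α∣<n = ℕ.≤-<-trans (subst (ℕ._≤ β ℕ.⊔ α) (cong ∣_∣ (sym (ℤ.[+m]-[+n]≡m⊖n β α))) (ℤ.∣m⊝n∣≤m⊔n β α))
                         (ℕ.⊔-pres-<m β<n α<n)

lemma12 : (a b c : ℤ) → disc a b c ≢ + 0 →
          (u v : ℤ) → InΨ a b c u v →
          (t : ℕ) → 0 ℕ.< t → (+ (t ℕ.* t)) ∣ F a b c u v →
          Σ ℕ (λ α → Σ ℕ (λ d → Σ ℕ (λ d' →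
            (InS a b c α d d' × InL α d d' u v × d ℕ.* d' ≡ t) ×
            ((α₂ d₂ d₂' : ℕ) → InS a b c α₂ d₂ d₂' → InL α₂ d₂ d₂' u v → d₂ ℕ.* d₂' ≡ t →
               (α₂ ≡ α) × (d₂ ≡ d) × (d₂' ≡ d')))))
lemma12 a b c _ u v (gcd≡1 , _) t 0<t t²∣F =
  α , d , d' , ((0<d , 0<d' , d⊥d' , α<d² , ∣cubicForm⇒∣f a b c u v (+ α) d²∣u-αv d²⊥v d²∣m) ,
                (d²∣u-αv , d'²∣n) , d*d'≡t) , uniqueness
  where
  G = cubicForm a b c u v
  v⊥G : Coprime v G
  v⊥G = coprime-cubicForm a b c u v (ℕ.gcd≡1⇒coprime (ℤ.+-injective gcd≡1))
  open CoprimeSplitting {{ℕ.>-nonZero 0<t}} (ℕ.sym v⊥G)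
    (subst (t ℕ.* t ℕ.∣_) (trans (ℤ.abs-* v G) (ℕ.*-comm ∣ v ∣ ∣ G ∣)) t²∣F)
  d²⊥v : Coprime (+ (d ℕ.* d)) v
  d²⊥v = coprime-∣ˡ d²∣m (ℕ.sym v⊥G)
  instance
    d≢0 : NonZero d
    d≢0 = ℕ.>-nonZero 0<d
  open ResidueClass {{ℕ.m*n≢0 d d}} u v d²⊥v renaming (α<n to α<d²; n∣u-αv to d²∣u-αv)
  uniqueness : (α₂ d₂ d₂' : ℕ) → InS a b c α₂ d₂ d₂' → InL α₂ d₂ d₂' u v → d₂ ℕ.* d₂' ≡ t →
               (α₂ ≡ α) × (d₂ ≡ d) × (d₂' ≡ d')
  uniqueness α₂ d₂ d₂' (_ , _ , _ , α₂<d₂² , d₂²∣fα₂) (d₂²∣u-α₂v , d₂'²∣v) d₂d₂'≡t =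
    let d₂≡d , d₂'≡d' = splitting-unique d₂d₂'≡t
          (ℕ.∣-trans (ℕ.m∣m*n d₂) (∣f⇒∣cubicForm a b c u v (+ α₂) d₂²∣u-α₂v d₂²∣fα₂))
          (ℕ.∣-trans (ℕ.m∣m*n d₂') d₂'²∣v)
    in residue-unique (subst (λ e → α₂ ℕ.< e ℕ.* e) d₂≡d α₂<d₂²)
                      (subst (λ e → + (e ℕ.* e) ∣ u - + α₂ * v) d₂≡d d₂²∣u-α₂v) , d₂≡d , d₂'≡d'
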